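{- For every System T type $A$ and every closed System T term $t$ of type $(\iota\Rightarrow\iota)\Rightarrow\iota$, we have $[\![\mathsf{dialogueTree}_A(t)]\!]\approx_{\mathsf{ChD}_A(\iota)}\mathsf{enc}_A(\mathsf{dialogueTree}(t))$.
   Context: Metatheory: constructive Martin-Löf type theory without function extensionality; $\mathsf{Natrec}\,f\,x\,0=x$, $\mathsf{Natrec}\,f\,x\,(n+1)=f\,n\,(\mathsf{Natrec}\,f\,x\,n)$. System T: types from base $\iota$ and $\sigma\Rightarrow\tau$; terms: variables, $\mathsf{zero}$, $\mathsf{succ}\,t$, $\mathsf{rec}_\sigma\,t\,p\,q:\sigma$ ($t:\iota\Rightarrow\sigma\Rightarrow\sigma$, $p:\sigma$, $q:\iota$), $\lambda$, application. Set interpretation $[\![\iota]\!]=\mathbb{N}$, $[\![\sigma\Rightarrow\tau]\!]=[\![\sigma]\!]\to[\![\tau]\!]$, standard on terms. Hereditarily extensional equality: $n\approx_\iota m$ iff $n=m$; $f\approx_{\sigma_1\Rightarrow\sigma_2}g$ iff $\forall x,y$, $x\approx y\Rightarrow f\,x\approx g\,y$. Dialogue trees $\mathcal{D}_{\mathbb N}\mathbb{N}$: inductive, constructors $\eta\,n$, $\beta\,\varphi\,i$. Kleisli $f^\sharp(\eta\,x)=f\,x$, $f^\sharp(\beta\,\varphi\,i)=\beta(\lambda o.f^\sharp(\varphi\,o))\,i$; $\mathsf{map}\,f=(\eta\circ f)^\sharp$. $\mathcal{B}[\![\iota]\!]=\mathcal{D}_{\mathbb N}\mathbb{N}$, arrows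 to function types; $\mathsf{ext}_\iota f\,d=f^\sharp d$, $\mathsf{ext}_{\sigma_1\Rightarrow\sigma_2}f\,d\,s=\mathsf{ext}_{\sigma_2}(\lambda x.f\,x\,s)\,d$; $\mathcal{B}[\![\mathsf{zero}]\!]\gamma=\eta\,0$, $\mathcal{B}[\![\mathsf{succ}\,t]\!]\gamma=\mathsf{map}(\lambda n.n+1)(\mathcal{B}[\![t]\!]\gamma)$, $\mathcal{B}[\![\mathsf{rec}_\sigma t_1t_2t_3]\!]\gamma=\mathsf{ext}_\sigma(\mathsf{Natrec}(\mathcal{B}[\![t_1]\!]\gamma\circ\eta)(\mathcal{B}[\![t_2]\!]\gamma))(\mathcal{B}[\![t_3]\!]\gamma)$, variables/$\lambda$/application standard. $\mathsf{generic}:=(\lambda i.\beta\,\eta\,i)^\sharp$; $\mathsf{dialogueTree}(t):=\mathcal{B}[\![t]\!]\,\mathsf{generic}$. Internal: $\mathsf{ChD}_A(\sigma):=(\sigma\Rightarrow A)\Rightarrow((\iota\Rightarrow A)\Rightarrow\iota\Rightarrow A)\Rightarrow A$; $\eta_A:=\lambda z\,e\,b.\,e\,z$; $\beta_A:=\lambda\varphi\,x\,e\,b.\,b(\lambda y.\varphi\,y\,e\,b)\,x$; $K_A:=\lambda f\,d\,e'\,b'.\,d(\lambda x.f\,x\,e'\,b')\,b'$; $\mathsf{map}_A:=\lambda f.K_A(\lambda x.\eta_A(f\,x))$. $\lceil\iota\rceil_A=\mathsf{ChD}_A(\iota)$, arrows homomorphically. $\mathsf{ext}^T_{\iota,A}:=K_A$,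 $\mathsf{ext}^T_{\sigma_1\Rightarrow\sigma_2,A}:=\lambda f\,d\,s.\mathsf{ext}^T_{\sigma_2,A}(\lambda x.f\,x\,s)\,d$. $\lceil x\rceil_A=x$, $\lceil\mathsf{zero}\rceil_A=\eta_A\,\mathsf{zero}$, $\lceil\mathsf{succ}\,t\rceil_A=\mathsf{map}_A(\lambda n.\mathsf{succ}\,n)\lceil t\rceil_A$, $\lceil\mathsf{rec}_\sigma t_1t_2t_3\rceil_A=\mathsf{ext}^T_{\sigma,A}(\lambda n.\mathsf{rec}_{\lceil\sigma\rceil_A}(\lambda x.\lceil t_1\rceil_A(\eta_A x))\lceil t_2\rceil_A\,n)\lceil t_3\rceil_A$, $\lambda$/application homomorphically. $\mathsf{generic}_A:=K_A(\lambda i.\beta_A\,\eta_A\,i)$; $\mathsf{dialogueTree}_A(t):=\lceil t\rceil_A\,\mathsf{generic}_A$. Encoding $\mathsf{enc}_A(\eta\,z)=[\![\eta_A]\!]z$, $\mathsf{enc}_A(\beta\,\varphi\,x)=[\![\beta_A]\!](\mathsf{enc}_A\circ\varphi)\,x$. -}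

module Defs where

open import Data.Nat using (ℕ; zero; suc)
open import Data.Unit using (⊤; tt)
open import Data.Product using (_×_; _,_; proj₁; proj₂)
open import Relation.Binary.PropositionalEquality using (_≡_)

Natrec : {X : Set} → (ℕ → X → X) → X → ℕ → X
Natrec f x zero    = x
Natrec f x (suc n) = f n (Natrec f x n)

infixr 30 _⇒_
data type : Set where
  ι   : type
  _⇒_ : type → type → type

infixl 25 _,,_
data Cxt : Set where
  ε    : Cxt
  _,,_ : Cxt → type → Cxt

data _∈_ : type → Cxt → Set where
  vz : ∀ {Γ σ} → σ ∈ (Γ ,, σ)
  vs : ∀ {Γ σ τ} → σ ∈ Γ → σ ∈ (Γ ,, τ)

infixl 20 _·_
data T (Γ : Cxt) : type → Set where
  var  : ∀ {σ} → σ ∈ Γ → T Γ σ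
  Zero : T Γ ι
  Succ : T Γ ι → T Γ ι
  Rec  : ∀ {σ} → T Γ (ι ⇒ σ ⇒ σ) → T Γ σ → T Γ ι → T Γ σ
  ƛ    : ∀ {σ τ} → T (Γ ,, σ) τ → T Γ (σ ⇒ τ)
  _·_  : ∀ {σ τ} → T Γ (σ ⇒ τ) → T Γ σ → T Γ τ

Ren : Cxt → Cxt → Set
Ren Γ Δ = ∀ {σ} → σ ∈ Γ → σ ∈ Δ

liftRen : ∀ {Γ Δ τ} → Ren Γ Δ → Ren (Γ ,, τ) (Δ ,, τ)
liftRen r vz     = vz
liftRen r (vs x) = vs (r x)

rename : ∀ {Γ Δ σ} → Ren Γ Δ → T Γ σ → T Δ σ
rename r (var x)     = var (r x)
rename r Zero        = Zero
rename r (Succ t)    = Succ (rename r t)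
rename r (Rec t p q) = Rec (rename r t) (rename r p) (rename r q)
rename r (ƛ t)       = ƛ (rename (liftRen r) t)
rename r (t · u)     = rename r t · rename r u

wk : ∀ {Γ σ τ} → T Γ σ → T (Γ ,, τ) σ
wk = rename vs

v0 : ∀ {Γ σ} → T (Γ ,, σ) σ
v0 = var vz
v1 : ∀ {Γ σ τ} → T (Γ ,, σ ,, τ) σ
v1 = var (vs vz)
v2 : ∀ {Γ σ τ₁ τ₂} → T (Γ ,, σ ,, τ₁ ,, τ₂) σ
v2 = var (vs (vs vz))
v3 : ∀ {Γ σ τ₁ τ₂ τ₃} → T (Γ ,, σ ,, τ₁ ,, τ₂ ,, τ₃) σ
v3 = var (vs (vs (vs vz)))
v4 : ∀ {Γ σ τ₁ τ₂ τ₃ τ₄} → T (Γ ,, σ ,, τ₁ ,, τ₂ ,, τ₃ ,, τ₄) σ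
v4 = var (vs (vs (vs (vs vz))))

⟦_⟧ʸ : type → Set
⟦ ι ⟧ʸ     = ℕ
⟦ σ ⇒ τ ⟧ʸ = ⟦ σ ⟧ʸ → ⟦ τ ⟧ʸ

⟦_⟧ᶜ : Cxt → Set
⟦ ε ⟧ᶜ      = ⊤
⟦ Γ ,, σ ⟧ᶜ = ⟦ Γ ⟧ᶜ × ⟦ σ ⟧ʸ

lookup : ∀ {Γ σ} → σ ∈ Γ → ⟦ Γ ⟧ᶜ → ⟦ σ ⟧ʸ
lookup vz     (γ , x) = x
lookup (vs i) (γ , x) = lookup i γ

⟦_⟧ : ∀ {Γ σ} → T Γ σ → ⟦ Γ ⟧ᶜ → ⟦ σ ⟧ʸ
⟦ var x ⟧     γ = lookup x γ
⟦ Zero ⟧      γ = zero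
⟦ Succ t ⟧    γ = suc (⟦ t ⟧ γ)
⟦ Rec t p q ⟧ γ = Natrec (⟦ t ⟧ γ) (⟦ p ⟧ γ) (⟦ q ⟧ γ)
⟦ ƛ t ⟧       γ = λ x → ⟦ t ⟧ (γ , x)
⟦ t · u ⟧     γ = ⟦ t ⟧ γ (⟦ u ⟧ γ)

⟦_⟧₀ : ∀ {σ} → T ε σ → ⟦ σ ⟧ʸ
⟦ t ⟧₀ = ⟦ t ⟧ tt

Heq : (σ : type) → ⟦ σ ⟧ʸ → ⟦ σ ⟧ʸ → Set
Heq ι       n m = n ≡ m
Heq (σ ⇒ τ) f g = ∀ x y → Heq σ x y → Heq τ (f x) (g y)

syntax Heq σ x y = x ≈⟨ σ ⟩ y

data D : Set where
  η : ℕ → D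
  β : (ℕ → D) → ℕ → D

_♯ : (ℕ → D) → D → D
(f ♯) (η x)   = f x
(f ♯) (β φ i) = β (λ o → (f ♯) (φ o)) i

mapD : (ℕ → ℕ) → D → D
mapD f = (λ x → η (f x)) ♯

B⟦_⟧ʸ : type → Set
B⟦ ι ⟧ʸ     = D
B⟦ σ ⇒ τ ⟧ʸ = B⟦ σ ⟧ʸ → B⟦ τ ⟧ʸ

B⟦_⟧ᶜ : Cxt → Set
B⟦ ε ⟧ᶜ      = ⊤
B⟦ Γ ,, σ ⟧ᶜ = B⟦ Γ ⟧ᶜ × B⟦ σ ⟧ʸ

Blookup : ∀ {Γ σ} → σ ∈ Γ → B⟦ Γ ⟧ᶜ → B⟦ σ ⟧ʸ
Blookup vz     (γ , x) = x
Blookup (vs i) (γ , x) = Blookup i γ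

ext : (σ : type) → (ℕ → B⟦ σ ⟧ʸ) → D → B⟦ σ ⟧ʸ
ext ι         f d   = (f ♯) d
ext (σ₁ ⇒ σ₂) f d s = ext σ₂ (λ x → f x s) d

B⟦_⟧ : ∀ {Γ σ} → T Γ σ → B⟦ Γ ⟧ᶜ → B⟦ σ ⟧ʸ
B⟦ var x ⟧ γ = Blookup x γ
B⟦ Zero ⟧ γ = η zero
B⟦ Succ t ⟧ γ = mapD suc (B⟦ t ⟧ γ)
B⟦ Rec {σ = σ} t₁ t₂ t₃ ⟧ γ =
  ext σ (Natrec (λ n → B⟦ t₁ ⟧ γ (η n)) (B⟦ t₂ ⟧ γ)) (B⟦ t₃ ⟧ γ)
B⟦ ƛ t ⟧ γ = λ x → B⟦ t ⟧ (γ , x)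
B⟦ t · u ⟧ γ = B⟦ t ⟧ γ (B⟦ u ⟧ γ)

generic : D → D
generic = (λ i → β η i) ♯

dialogueTree : T ε ((ι ⇒ ι) ⇒ ι) → D
dialogueTree t = B⟦ t ⟧ tt generic

-- Internal (Church-encoded) dialogue trees and the ⌈_⌉_A translation

ChD : type → type → type
ChD A σ = (σ ⇒ A) ⇒ ((ι ⇒ A) ⇒ ι ⇒ A) ⇒ A

-- η_A = λ z e b. e z
ηA : ∀ {Γ} A → T Γ (ι ⇒ ChD A ι)
ηA A = ƛ (ƛ (ƛ (v1 · v2)))

-- β_A = λ φ x e b. b (λ y. φ y e b) x
βA : ∀ {Γ} A → T Γ ((ι ⇒ ChD A ι) ⇒ ι ⇒ ChD A ι)
βA A = ƛ (ƛ (ƛ (ƛ (v0 · ƛ (v4 · v0 · v2 · v1) · v2))))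

-- K_A = λ f d e' b'. d (λ x. f x e' b') b'
KA : ∀ {Γ} A → T Γ ((ι ⇒ ChD A ι) ⇒ ChD A ι ⇒ ChD A ι)
KA A = ƛ (ƛ (ƛ (ƛ (v2 · ƛ (v4 · v0 · v2 · v1) · v0))))

-- map_A = λ f. K_A (λ x. η_A (f x))
mapA : ∀ {Γ} A → T Γ ((ι ⇒ ι) ⇒ ChD A ι ⇒ ChD A ι)
mapA A = ƛ (KA A · ƛ (ηA A · (v1 · v0)))

⌈_⌉ʸ : type → type → type
⌈ ι ⌉ʸ     A = ChD A ι
⌈ σ ⇒ τ ⌉ʸ A = ⌈ σ ⌉ʸ A ⇒ ⌈ τ ⌉ʸ A

⌈_⌉ᶜ : Cxt → type → Cxt
⌈ ε ⌉ᶜ      A = ε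
⌈ Γ ,, σ ⌉ᶜ A = ⌈ Γ ⌉ᶜ A ,, ⌈ σ ⌉ʸ A

⌈_⌉ᵛ : ∀ {Γ σ} → σ ∈ Γ → (A : type) → ⌈ σ ⌉ʸ A ∈ ⌈ Γ ⌉ᶜ A
⌈ vz ⌉ᵛ   A = vz
⌈ vs i ⌉ᵛ A = vs (⌈ i ⌉ᵛ A)

extT : ∀ {Γ} (σ : type) A → T Γ ((ι ⇒ ⌈ σ ⌉ʸ A) ⇒ ChD A ι ⇒ ⌈ σ ⌉ʸ A)
extT ι         A = KA A
extT (σ₁ ⇒ σ₂) A = ƛ (ƛ (ƛ (extT σ₂ A · ƛ (v3 · v0 · v1) · v1)))

⌈_⌉ : ∀ {Γ σ} → T Γ σ → (A : type) → T (⌈ Γ ⌉ᶜ A) (⌈ σ ⌉ʸ A)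
⌈ var x ⌉ A = var (⌈ x ⌉ᵛ A)
⌈ Zero ⌉ A = ηA A · Zero
⌈ Succ t ⌉ A = mapA A · ƛ (Succ v0) · ⌈ t ⌉ A
⌈ Rec {σ = σ} t₁ t₂ t₃ ⌉ A =
  extT σ A
    · ƛ (Rec (ƛ (wk (wk (⌈ t₁ ⌉ A)) · (ηA A · v0))) (wk (⌈ t₂ ⌉ A)) v0)
    · ⌈ t₃ ⌉ A
⌈ ƛ t ⌉ A = ƛ (⌈ t ⌉ A)
⌈ t · u ⌉ A = ⌈ t ⌉ A · ⌈ u ⌉ A

genericA : ∀ {Γ} A → T Γ (ChD A ι ⇒ ChD A ι)
genericA A = KA A · ƛ (βA A · ηA A · v0)

dialogueTreeA : (A : type) → T ε ((ι ⇒ ι) ⇒ ι) → T ε (ChD A ι)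
dialogueTreeA A t = ⌈ t ⌉ A · genericA A

enc : (A : type) → D → ⟦ ChD A ι ⟧ʸ
enc A (η z)   = ⟦ ηA A ⟧₀ z
enc A (β φ x) = ⟦ βA A ⟧₀ (λ o → enc A (φ o)) x

-- The proof is a logical relation between the standard semantics of the
-- translated term and the dialogue semantics of the original one: at ι an
-- internal tree is related to an external tree d when it is hereditarily
-- extensionally equal to enc A d, and at arrow types related arguments go to
-- related results.  The crux is that K_A implements the Kleisli extension
-- _♯ under enc; everything else (ext, η, map, generic, recursion) is built
-- from K_A, so the fundamental lemma follows by induction on terms.
module Submission where

open import Defs
open import Data.Nat using (ℕ; zero; suc)
open import Data.Unit using (tt)
open import Data.Product using (_,_)
open import Function using (id; _∘_)
open import Relation.Binary.PropositionalEquality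
  using (_≡_; refl; sym; trans; cong; cong₂; subst)

rename-cong : ∀ {Γ Δ σ} {r r′ : Ren Γ Δ} → (∀ {τ} (x : τ ∈ Γ) → r x ≡ r′ x)
            → (t : T Γ σ) → rename r t ≡ rename r′ t
rename-cong r≡r′ (var x)     = cong var (r≡r′ x)
rename-cong r≡r′ Zero        = refl
rename-cong r≡r′ (Succ t)    = cong Succ (rename-cong r≡r′ t)
rename-cong r≡r′ (Rec t p q)
  rewrite rename-cong r≡r′ t | rename-cong r≡r′ p | rename-cong r≡r′ q = refl
rename-cong r≡r′ (ƛ t)       = cong ƛ (rename-cong lift≡ t)
  where
  lift≡ : ∀ {τ σ} (x : τ ∈ (_ ,, σ)) → liftRen _ x ≡ liftRen _ x
  lift≡ vz     = refl
  lift≡ (vs x) = cong vs (r≡r′ x)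
rename-cong r≡r′ (t · u)     = cong₂ _·_ (rename-cong r≡r′ t) (rename-cong r≡r′ u)

rename-∘ : ∀ {Γ Δ Θ σ} (r : Ren Δ Θ) (s : Ren Γ Δ) (t : T Γ σ)
         → rename r (rename s t) ≡ rename (r ∘ s) t
rename-∘ r s (var x)     = refl
rename-∘ r s Zero        = refl
rename-∘ r s (Succ t)    = cong Succ (rename-∘ r s t)
rename-∘ r s (Rec t p q)
  rewrite rename-∘ r s t | rename-∘ r s p | rename-∘ r s q = refl
rename-∘ r s (ƛ t)       =
  cong ƛ (trans (rename-∘ (liftRen r) (liftRen s) t) (rename-cong lift-∘ t))
  where
  lift-∘ : ∀ {τ σ} (x : τ ∈ (_ ,, σ)) → liftRen r (liftRen s x) ≡ liftRen (r ∘ s) x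
  lift-∘ vz     = refl
  lift-∘ (vs x) = refl
rename-∘ r s (t · u)     = cong₂ _·_ (rename-∘ r s t) (rename-∘ r s u)

rename-id : ∀ {Γ σ} (t : T Γ σ) → rename id t ≡ t
rename-id (var x)     = refl
rename-id Zero        = refl
rename-id (Succ t)    = cong Succ (rename-id t)
rename-id (Rec t p q) rewrite rename-id t | rename-id p | rename-id q = refl
rename-id (ƛ t)       = cong ƛ (trans (rename-cong lift-id t) (rename-id t))
  where
  lift-id : ∀ {τ σ} (x : τ ∈ (_ ,, σ)) → liftRen id x ≡ x
  lift-id vz     = refl
  lift-id (vs x) = refl
rename-id (t · u)     = cong₂ _·_ (rename-id t) (rename-id u)

rename-wk : ∀ {Γ Δ σ τ} (r : Ren (Γ ,, τ) Δ) (t : T Γ σ)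
          → rename r (wk t) ≡ rename (r ∘ vs) t
rename-wk r = rename-∘ r vs

Heq-sym : ∀ σ {x y} → x ≈⟨ σ ⟩ y → y ≈⟨ σ ⟩ x
Heq-sym ι       x≡y         = sym x≡y
Heq-sym (σ ⇒ τ) f≈g a b a≈b = Heq-sym τ (f≈g b a (Heq-sym σ a≈b))

Heq-trans : ∀ σ {x y z} → x ≈⟨ σ ⟩ y → y ≈⟨ σ ⟩ z → x ≈⟨ σ ⟩ z
Heq-trans ι       x≡y y≡z           = trans x≡y y≡z
Heq-trans (σ ⇒ τ) f≈g g≈h a c a≈c =
  Heq-trans τ (f≈g a c a≈c) (g≈h c c (Heq-trans σ (Heq-sym σ a≈c) a≈c))

Heq-reflʳ : ∀ σ {x y} → x ≈⟨ σ ⟩ y → y ≈⟨ σ ⟩ y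
Heq-reflʳ σ x≈y = Heq-trans σ (Heq-sym σ x≈y) x≈y

Natrec-preserves : ∀ {X Y : Set} (P : X → Y → Set)
                   {f : ℕ → X → X} {g : ℕ → Y → Y} {x : X} {y : Y}
                 → (∀ n {a b} → P a b → P (f n a) (g n b)) → P x y
                 → ∀ n → P (Natrec f x n) (Natrec g y n)
Natrec-preserves P f∼g x∼y zero    = x∼y
Natrec-preserves P f∼g x∼y (suc n) = f∼g n (Natrec-preserves P f∼g x∼y n)

module _ (A : type) where

  Related : (σ : type) → ⟦ ⌈ σ ⌉ʸ A ⟧ʸ → B⟦ σ ⟧ʸ → Set
  Related ι       x d = x ≈⟨ ChD A ι ⟩ enc A d
  Related (σ ⇒ τ) f g = ∀ x d → Related σ x d → Related τ (f x) (g d)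

  enc-refl : ∀ d → enc A d ≈⟨ ChD A ι ⟩ enc A d
  enc-refl (η z)   e e′ e≈e′ b b′ b≈b′ = e≈e′ z z refl
  enc-refl (β φ x) e e′ e≈e′ b b′ b≈b′ =
    b≈b′ _ _ (λ { y .y refl → enc-refl (φ y) e e′ e≈e′ b b′ b≈b′ }) x x refl

  enc-♯ : (g : ℕ → D) (d : D) {e e′ : ⟦ ι ⇒ A ⟧ʸ} → e ≈⟨ ι ⇒ A ⟩ e′
        → {b b′ : ⟦ (ι ⇒ A) ⇒ ι ⇒ A ⟧ʸ} → b ≈⟨ (ι ⇒ A) ⇒ ι ⇒ A ⟩ b′
        → enc A d (λ y → enc A (g y) e b) b ≈⟨ A ⟩ enc A ((g ♯) d) e′ b′
  enc-♯ g (η z)   e≈e′ b≈b′ = enc-refl (g z) _ _ e≈e′ _ _ b≈b′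
  enc-♯ g (β φ x) e≈e′ b≈b′ =
    b≈b′ _ _ (λ { y .y refl → enc-♯ g (φ y) e≈e′ b≈b′ }) x x refl

  KA-♯ : ∀ {Γ} (γ : ⟦ Γ ⟧ᶜ) {f : ℕ → ⟦ ChD A ι ⟧ʸ} {g : ℕ → D}
       → (∀ n → Related ι (f n) (g n))
       → Related (ι ⇒ ι) (⟦ KA A ⟧ γ f) (g ♯)
  KA-♯ γ f∼g x d x∼d e e′ e≈e′ b b′ b≈b′ =
    Heq-trans A
      (x∼d _ _ (λ { y .y refl → f∼g y e e′ e≈e′ b b′ b≈b′ }) b b′ b≈b′)
      (enc-♯ _ d (Heq-reflʳ (ι ⇒ A) e≈e′) (Heq-reflʳ ((ι ⇒ A) ⇒ ι ⇒ A) b≈b′))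

  mapA-mapD : ∀ {Γ} (γ : ⟦ Γ ⟧ᶜ) (f : ℕ → ℕ)
            → Related (ι ⇒ ι) (⟦ mapA A ⟧ γ f) (mapD f)
  mapA-mapD γ f = KA-♯ (γ , f) (λ n → enc-refl (η (f n)))

  genericA-generic : ∀ {Γ} (γ : ⟦ Γ ⟧ᶜ) → Related (ι ⇒ ι) (⟦ genericA A ⟧ γ) generic
  genericA-generic γ = KA-♯ γ (λ i → enc-refl (β η i))

  extT-ext : ∀ σ {Δ Θ} (r : Ren Δ Θ) (γ : ⟦ Θ ⟧ᶜ)
             {f : ℕ → ⟦ ⌈ σ ⌉ʸ A ⟧ʸ} {g : ℕ → B⟦ σ ⟧ʸ}
           → (∀ n → Related σ (f n) (g n))
           → Related (ι ⇒ σ) (⟦ rename r (extT σ A) ⟧ γ f) (ext σ g)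
  extT-ext ι         r γ f∼g             = KA-♯ γ f∼g
  extT-ext (σ₁ ⇒ σ₂) r γ f∼g x d x∼d s s′ s∼s′ =
    extT-ext σ₂ _ _ (λ n → f∼g n s s′ s∼s′) x d x∼d

  RelatedEnv : ∀ {Γ Δ} → Ren (⌈ Γ ⌉ᶜ A) Δ → ⟦ Δ ⟧ᶜ → B⟦ Γ ⟧ᶜ → Set
  RelatedEnv {Γ} r γ δ =
    ∀ {σ} (x : σ ∈ Γ) → Related σ (lookup (r (⌈ x ⌉ᵛ A)) γ) (Blookup x δ)

  -- Quantifying over renamings lets the weakenings in ⌈ Rec ⌉ be absorbed
  -- without function extensionality.
  fundamental : ∀ {Γ σ Δ} (t : T Γ σ) (r : Ren (⌈ Γ ⌉ᶜ A) Δ) (γ : ⟦ Δ ⟧ᶜ) (δ : B⟦ Γ ⟧ᶜ)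
              → RelatedEnv r γ δ → Related σ (⟦ rename r (⌈ t ⌉ A) ⟧ γ) (B⟦ t ⟧ δ)
  fundamental (var x)  r γ δ γ∼δ = γ∼δ x
  fundamental Zero     r γ δ γ∼δ = enc-refl (η zero)
  fundamental (Succ t) r γ δ γ∼δ =
    mapA-mapD γ suc _ (B⟦ t ⟧ δ) (fundamental t r γ δ γ∼δ)
  fundamental {Δ = Δ} (Rec {σ = σ} t₁ t₂ t₃) r γ δ γ∼δ =
    extT-ext σ r γ (λ n → Natrec-preserves (Related σ) (step n) (base n) n)
      _ _ (fundamental t₃ r γ δ γ∼δ)
    where
    t₁↑ : T (Δ ,, ι ,, ι) (⌈ ι ⇒ σ ⇒ σ ⌉ʸ A)
    t₁↑ = rename (liftRen (liftRen r)) (wk (wk (⌈ t₁ ⌉ A)))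

    t₂↑ : T (Δ ,, ι) (⌈ σ ⌉ʸ A)
    t₂↑ = rename (liftRen r) (wk (⌈ t₂ ⌉ A))

    t₁↑≡ : t₁↑ ≡ rename (vs ∘ vs ∘ r) (⌈ t₁ ⌉ A)
    t₁↑≡ = trans (rename-wk _ (wk (⌈ t₁ ⌉ A))) (rename-wk _ (⌈ t₁ ⌉ A))

    step : ∀ n m {a b} → Related σ a b
         → Related σ (⟦ t₁↑ ⟧ ((γ , n) , m) (⟦ ηA A ⟧₀ m) a) (B⟦ t₁ ⟧ δ (η m) b)
    step n m =
      subst (λ s → Related (ι ⇒ σ ⇒ σ) (⟦ s ⟧ ((γ , n) , m)) (B⟦ t₁ ⟧ δ)) (sym t₁↑≡)
            (fundamental t₁ _ ((γ , n) , m) δ γ∼δ) _ (η m) (enc-refl (η m)) _ _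

    base : ∀ n → Related σ (⟦ t₂↑ ⟧ (γ , n)) (B⟦ t₂ ⟧ δ)
    base n =
      subst (λ s → Related σ (⟦ s ⟧ (γ , n)) (B⟦ t₂ ⟧ δ)) (sym (rename-wk _ (⌈ t₂ ⌉ A)))
            (fundamental t₂ _ (γ , n) δ γ∼δ)

  fundamental (ƛ t)   r γ δ γ∼δ a d a∼d = fundamental t (liftRen r) (γ , a) (δ , d) γa∼δd
    where
    γa∼δd : RelatedEnv (liftRen r) (γ , a) (δ , d)
    γa∼δd vz     = a∼d
    γa∼δd (vs x) = γ∼δ x
  fundamental (t · u) r γ δ γ∼δ = fundamental t r γ δ γ∼δ _ _ (fundamental u r γ δ γ∼δ)

  fundamental-closed : ∀ {σ} (t : T ε σ) → Related σ ⟦ ⌈ t ⌉ A ⟧₀ (B⟦ t ⟧ tt)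
  fundamental-closed {σ} t =
    subst (λ s → Related σ ⟦ s ⟧₀ (B⟦ t ⟧ tt)) (rename-id (⌈ t ⌉ A))
          (fundamental t id tt tt (λ ()))

lemma34 : (A : type) (t : T ε ((ι ⇒ ι) ⇒ ι))
        → ⟦ dialogueTreeA A t ⟧₀ ≈⟨ ChD A ι ⟩ enc A (dialogueTree t)
lemma34 A t = fundamental-closed A t _ _ (genericA-generic A tt)
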